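{- Let $k\ge 2$ and let $M$ be a strong $k$-chromatic-choosable graph. Then for every positive integer $s$, $\chi_\ell(M \square K_{1,s}) = k$ if $s < P_\ell(M,k)$, and $\chi_\ell(M \square K_{1,s}) = k+1$ if $s \ge P_\ell(M,k)$.
   Context: All graphs are finite and simple. A list assignment $L$ for $G$ assigns a set of colors $L(v)$ to each vertex; it is a $k$-assignment if all lists have size $k$. A proper $L$-coloring is a proper coloring $f$ with $f(v)\in L(v)$ for all $v$; $G$ is $L$-colorable if one exists. $\chi_\ell(G)$ is the least $k$ such that $G$ is $L$-colorable whenever all lists have size at least $k$. A list assignment is constant if all lists are equal. $G$ is strong $k$-chromatic-choosable if $\chi(G)=k$ and every $(k-1)$-assignment $L$ for which $G$ is not $L$-colorable is constant. $P(G,L)$ denotes the number of proper $L$-colorings of $G$, and the list color function $P_\ell(G,k)$ is the minimum of $P(G,L)$ over all $k$-assignments $L$ for $G$. $\square$ denotes the Cartesian product of graphs: $(u,v)\sim(u',v')$ iff ($u=u'$ and $vv'\in E$) or ($v=v'$ and $uu'\in E$). $K_{1,s}$ is the star with $s$ leaves. -}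

module Defs where

open import Data.Nat using (ℕ; zero; suc; _*_; _≤_; _<_)
import Data.Nat.Properties as ℕP
open import Data.Fin using (Fin; zero; suc; remQuot)
import Data.Fin.Properties as FinP
open import Data.Bool using (Bool; true; false; _∧_; _∨_)
open import Data.List using (List; []; _∷_; map; concatMap; length; filter)
open import Data.List.Membership.Propositional using (_∈_)
open import Data.List.Relation.Unary.Unique.Propositional using (Unique)
open import Data.Vec using (Vec; []; _∷_; lookup)
open import Data.Product using (Σ; ∃; _×_; _,_)
open import Relation.Binary.PropositionalEquality using (_≡_; _≢_)
open import Relation.Nullary using (¬_; Dec; yes; no)
open import Relation.Nullary.Decidable using (⌊_⌋; _→-dec_; ¬?)

record Graph : Set where
  field
    size : ℕ
    adj  : Fin size → Fin size → Bool
open Graph public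

IsSimple : Graph → Set
IsSimple G = (∀ u v → adj G u v ≡ adj G v u) × (∀ v → adj G v v ≡ false)

-- Cartesian product G □ H; vertex (u , v) is encoded via remQuot.
_□_ : Graph → Graph → Graph
G □ H = record { size = size G * size H ; adj = a }
  where
  a : Fin (size G * size H) → Fin (size G * size H) → Bool
  a i j with remQuot (size H) i | remQuot (size H) j
  ... | (u , v) | (u' , v') =
        (⌊ u FinP.≟ u' ⌋ ∧ adj H v v') ∨ (⌊ v FinP.≟ v' ⌋ ∧ adj G u u')

Star : ℕ → Graph
Star s = record { size = suc s ; adj = a }
  where
  a : Fin (suc s) → Fin (suc s) → Bool
  a zero    (suc _) = true
  a (suc _) zero    = true
  a _       _       = false

Coloring : Graph → Set
Coloring G = Vec ℕ (size G)

Proper : (G : Graph) → Coloring G → Set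
Proper G f = ∀ u v → adj G u v ≡ true → lookup f u ≢ lookup f v

Colorable : Graph → ℕ → Set
Colorable G k = Σ (Coloring G) λ f → Proper G f × (∀ v → lookup f v < k)

ChromaticNumber : Graph → ℕ → Set
ChromaticNumber G k = Colorable G k × (∀ j → j < k → ¬ Colorable G j)

-- List assignments.  Lists are duplicate-free, so |L(v)| = length (L v).

ListAssignment : Graph → Set
ListAssignment G = Fin (size G) → List ℕ

IsKAssignment : (G : Graph) → ℕ → ListAssignment G → Set
IsKAssignment G k L = ∀ v → Unique (L v) × length (L v) ≡ k

IsAtLeastKAssignment : (G : Graph) → ℕ → ListAssignment G → Set
IsAtLeastKAssignment G k L = ∀ v → Unique (L v) × k ≤ length (L v)

IsConstant : (G : Graph) → ListAssignment G → Set
IsConstant G L = ∀ u v (x : ℕ) → x ∈ L u → x ∈ L v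

IsLColoring : (G : Graph) → ListAssignment G → Coloring G → Set
IsLColoring G L f = Proper G f × (∀ v → lookup f v ∈ L v)

LColorable : (G : Graph) → ListAssignment G → Set
LColorable G L = Σ (Coloring G) (IsLColoring G L)

Choosable : Graph → ℕ → Set
Choosable G k = ∀ (L : ListAssignment G) → IsAtLeastKAssignment G k L → LColorable G L

ListChromaticNumber : Graph → ℕ → Set
ListChromaticNumber G k = Choosable G k × (∀ j → j < k → ¬ Choosable G j)

StrongChromaticChoosable : Graph → ℕ → Set
StrongChromaticChoosable G k =
  ChromaticNumber G k ×
  (∀ (L : ListAssignment G) → IsKAssignment G (k Data.Nat.∸ 1) L →
     ¬ LColorable G L → IsConstant G L)

-- all choice vectors f with f v ∈ L v (no repetitions if the lists are
-- duplicate-free)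
choices : (n : ℕ) → (Fin n → List ℕ) → List (Vec ℕ n)
choices zero    L = [] ∷ []
choices (suc n) L =
  concatMap (λ c → map (c ∷_) (choices n (λ i → L (suc i)))) (L zero)

proper? : (G : Graph) → (f : Coloring G) → Dec (Proper G f)
proper? G f =
  FinP.all? λ u → FinP.all? λ v →
    (adj G u v Data.Bool.≟ true) →-dec ¬? (lookup f u ℕP.≟ lookup f v)

numLColorings : (G : Graph) → ListAssignment G → ℕ
numLColorings G L = length (filter (proper? G) (choices (size G) L))

IsListColorFunctionValue : Graph → ℕ → ℕ → Set
IsListColorFunctionValue G k m =
  (Σ (ListAssignment G) λ L → IsKAssignment G k L × numLColorings G L ≡ m) ×
  (∀ (L : ListAssignment G) → IsKAssignment G k L → m ≤ numLColorings G L)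

-- If an assignment with lists of size at least k − 1 does not color a strong
-- k-chromatic-choosable M, neither does any (k − 1)-subassignment, so all of these are
-- constant and hence so is the assignment itself; a constant assignment by lists of size k
-- colors M by relabelling a k-coloring. Consequently M is k-choosable, and for lists of size at
-- least k, deleting the colors c(u) of a proper coloring c leaves an uncolorable
-- assignment for at most one c.
--
-- Color M □ K_{1,s} by a proper coloring c of the centre copy and color each leaf copy
-- from its lists with c(u) deleted. With lists of size k + 1 any c works. With lists of
-- size k and s < P_ℓ(M,k), the centre has more than s colorings from k-sublists of its
-- lists, and each of the s leaves rules out at most one of them. Conversely, if
-- s ≥ P_ℓ(M,k) = P(M,L₀), give the centre the lists L₀ and leaf i the lists
-- {c_i(u)} ∪ S, where c_1, …, c_m are the L₀-colorings and S is a common set of k − 1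
-- fresh colors: the centre uses some c_i, which forces a (k − 1)-coloring of M on leaf i.

module Submission where

open import Data.Bool using (Bool; true; false; _∧_; _∨_)
open import Data.Bool.Properties using (∨-zeroʳ)
open import Data.Empty using (⊥-elim)
open import Data.Fin using (Fin; zero; suc; toℕ; fromℕ<; combine; remQuot)
import Data.Fin.Properties as Fin
open import Data.List
  using (List; []; _∷_; length; filter; take; map; concatMap; applyUpTo; upTo; allFin; cartesianProductWith)
import Data.List as List
open import Data.List.Properties using (filter-all; length-take; length-applyUpTo; length-upTo)
open import Data.List.Extrema.Nat using (max; xs≤max)
open import Data.List.Membership.Propositional using (_∈_; _∉_; find; lose)
open import Data.List.Membership.Propositional.Properties
  using (∈-filter⁻; ∈-filter⁺; ∈-lookup; ∈-applyUpTo⁻; ∈-concatMap⁺; ∈-tabulate⁺; ∈-allFin;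
         ∈-cartesianProductWith⁺; ∈-cartesianProductWith⁻)
import Data.List.Relation.Binary.Sublist.Propositional as Sublist
open import Data.List.Relation.Binary.Sublist.Propositional.Properties using (take-⊆)
open import Data.List.Relation.Unary.All as All using (All; [])
open import Data.List.Relation.Unary.All.Properties using (¬Any⇒All¬)
open import Data.List.Relation.Unary.Any using (here; there; any?; index)
open import Data.List.Relation.Unary.Any.Properties using (lookup-index)
open import Data.List.Relation.Unary.AllPairs using ([]; _∷_)
open import Data.List.Relation.Unary.Unique.Propositional using (Unique)
open import Data.List.Relation.Unary.Unique.Propositional.Properties
  using (filter⁺; take⁺; upTo⁺; applyUpTo⁺₁; cartesianProductWith⁺)
open import Data.Nat using (ℕ; zero; suc; _+_; _≤_; _<_; z≤n; s≤s; _≟_)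
open import Data.List.Membership.DecPropositional _≟_ using (_∈?_)
open import Data.Nat.Properties
open import Data.Product using (∃; _×_; _,_; proj₁; proj₂; uncurry)
open import Data.Sum using (_⊎_; inj₁; inj₂; [_,_]′)
open import Data.Vec using (Vec; lookup; tabulate; replicate)
import Data.Vec as Vec
open import Data.Vec.Properties using (lookup∘tabulate; ∷-injective)
open import Data.Vec.Relation.Binary.Pointwise.Extensional using (ext; Pointwise-≡⇒≡)
open import Function using (_∘_)
open import Relation.Binary.PropositionalEquality
open import Relation.Nullary using (¬_; Dec; yes; no; contradiction)
open import Relation.Nullary.Decidable using (⌊_⌋; ¬?; map′; decidable-stable)
open import Relation.Unary using (Decidable)

open import Defs

module _ {A : Set} {P : A → Set} (P? : Decidable P) where

  length≤suc-length-filter : ∀ {xs} → Unique xs →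
    (∀ {x y} → x ∈ xs → y ∈ xs → ¬ P x → ¬ P y → x ≡ y) →
    length xs ≤ suc (length (filter P? xs))
  length≤suc-length-filter {[]} _ _ = z≤n
  length≤suc-length-filter {x ∷ xs} (x∉xs ∷ u) once with P? x
  ... | yes _ = s≤s (length≤suc-length-filter u (λ p q → once (there p) (there q)))
  ... | no ¬px = s≤s (≤-reflexive (cong length (sym (filter-all P? (All.tabulate others)))))
    where
    others : ∀ {y} → y ∈ xs → P y
    others {y} y∈xs with P? y
    ... | yes py = py
    ... | no ¬py = ⊥-elim (All.lookup x∉xs y∈xs (once (here refl) (there y∈xs) ¬px ¬py))

∃-common-witness : ∀ {A : Set} s (C : List A) → Unique C → s < length C →
  (Q : Fin s → A → Set) → (∀ i → Decidable (Q i)) →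
  (∀ i {x y} → x ∈ C → y ∈ C → ¬ Q i x → ¬ Q i y → x ≡ y) →
  ∃ λ x → x ∈ C × ∀ i → Q i x
∃-common-witness zero (x ∷ _) _ _ _ _ _ = x , here refl , λ ()
∃-common-witness (suc s) C u s<|C| Q Q? once
  with ∃-common-witness s (filter (Q? zero) C) (filter⁺ (Q? zero) u)
         (≤-pred (≤-trans s<|C| (length≤suc-length-filter (Q? zero) u (once zero))))
         (Q ∘ suc) (Q? ∘ suc)
         (λ i p q → once (suc i) (proj₁ (∈-filter⁻ (Q? zero) p)) (proj₁ (∈-filter⁻ (Q? zero) q)))
... | x , x∈ , Qx with ∈-filter⁻ (Q? zero) x∈
...   | x∈C , Q₀x = x , x∈C , λ { zero → Q₀x ; (suc i) → Qx i }

lookup-injective : ∀ {A : Set} {xs : List A} → Unique xs →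
  ∀ {i j} → List.lookup xs i ≡ List.lookup xs j → i ≡ j
lookup-injective {xs = _ ∷ _} _ {zero} {zero} _ = refl
lookup-injective {xs = _ ∷ _} (x∉ ∷ _) {zero} {suc j} eq = ⊥-elim (All.lookup x∉ (∈-lookup j) eq)
lookup-injective {xs = _ ∷ _} (x∉ ∷ _) {suc i} {zero} eq = ⊥-elim (All.lookup x∉ (∈-lookup i) (sym eq))
lookup-injective {xs = _ ∷ _} (_ ∷ u) {suc i} {suc j} eq = cong suc (lookup-injective u eq)

enumerate : ∀ {A : Set} {s} (d : A) (C : List A) → length C ≤ s →
  ∃ λ (e : Fin s → A) → ∀ {x} → x ∈ C → ∃ λ i → e i ≡ x
enumerate d [] _ = (λ _ → d) , λ ()
enumerate {s = suc s} d (x ∷ C) (s≤s |C|≤s) with enumerate d C |C|≤s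
... | e , onto = (λ { zero → x ; (suc i) → e i })
               , λ { (here refl) → zero , refl ; (there p) → let i , ei≡ = onto p in suc i , ei≡ }

fresh-colors : (F : List ℕ) (j : ℕ) → ∃ λ S → Unique S × length S ≡ j × ∀ {x} → x ∈ S → x ∉ F
fresh-colors F j = S , applyUpTo⁺₁ (N +_) j (λ i<i' _ → <⇒≢ i<i' ∘ +-cancelˡ-≡ N _ _)
              , length-applyUpTo (N +_) j , away
  where
  N = suc (max 0 F)
  S = applyUpTo (N +_) j
  away : ∀ {x} → x ∈ S → x ∉ F
  away x∈S x∈F with ∈-applyUpTo⁻ (N +_) x∈S
  ... | i , _ , refl = <⇒≱ (s≤s (All.lookup (xs≤max 0 F) x∈F)) (m≤m+n N i)

∈-take : ∀ {A : Set} {x : A} {n xs} → x ∈ take n xs → x ∈ xs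
∈-take {n = n} {xs} = Sublist.lookup (take-⊆ n xs)

length-take-≤ : ∀ {A : Set} {n} {xs : List A} → n ≤ length xs → length (take n xs) ≡ n
length-take-≤ {n = n} {xs} n≤ = trans (length-take n xs) (m≤n⇒m⊓n≡m n≤)

vertex-or-empty : ∀ n → Fin n ⊎ ¬ Fin n
vertex-or-empty zero    = inj₂ λ ()
vertex-or-empty (suc n) = inj₁ zero

remove : ℕ → List ℕ → List ℕ
remove x = filter (λ y → ¬? (y ≟ x))

∈-remove⁻ : ∀ {x y} xs → y ∈ remove x xs → y ∈ xs × y ≢ x
∈-remove⁻ {x} xs = ∈-filter⁻ (λ y → ¬? (y ≟ x)) {xs = xs}

∈-remove⁺ : ∀ {x y xs} → y ∈ xs → y ≢ x → y ∈ remove x xs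
∈-remove⁺ {x} = ∈-filter⁺ (λ y → ¬? (y ≟ x))

remove-unique : ∀ {x xs} → Unique xs → Unique (remove x xs)
remove-unique {x} = filter⁺ (λ y → ¬? (y ≟ x))

remove-∉ : ∀ {x xs} → x ∉ xs → remove x xs ≡ xs
remove-∉ {x} x∉ = filter-all (λ y → ¬? (y ≟ x)) (All.map (_∘ sym) (¬Any⇒All¬ _ x∉))

length-remove : ∀ {x xs} → Unique xs → length xs ≤ suc (length (remove x xs))
length-remove {x} u = length≤suc-length-filter (λ y → ¬? (y ≟ x)) u
  (λ _ _ ¬y≢x ¬z≢x → trans (decidable-stable (_ ≟ x) ¬y≢x) (sym (decidable-stable (_ ≟ x) ¬z≢x)))

_∖_ : ∀ {n} → (Fin n → List ℕ) → (Fin n → ℕ) → Fin n → List ℕ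
(A ∖ c) v = remove (c v) (A v)

concatMap≡cartesianProductWith : ∀ {A B C : Set} (f : A → B → C) xs ys →
  concatMap (λ x → map (f x) ys) xs ≡ cartesianProductWith f xs ys
concatMap≡cartesianProductWith f []       ys = refl
concatMap≡cartesianProductWith f (x ∷ xs) ys =
  cong (map (f x) ys List.++_) (concatMap≡cartesianProductWith f xs ys)

choices-suc : ∀ n (L : Fin (suc n) → List ℕ) →
  choices (suc n) L ≡ cartesianProductWith Vec._∷_ (L zero) (choices n (L ∘ suc))
choices-suc n L = concatMap≡cartesianProductWith Vec._∷_ (L zero) (choices n (L ∘ suc))

∈-choices⁻ : ∀ n (L : Fin n → List ℕ) {f} → f ∈ choices n L → ∀ i → lookup f i ∈ L i
∈-choices⁻ (suc n) L f∈
  with ∈-cartesianProductWith⁻ Vec._∷_ (L zero) (choices n (L ∘ suc))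
         (subst (_ ∈_) (choices-suc n L) f∈)
... | c , t , c∈ , t∈ , refl = λ { zero → c∈ ; (suc i) → ∈-choices⁻ n (L ∘ suc) t∈ i }

∈-choices⁺ : ∀ n (L : Fin n → List ℕ) (f : Vec ℕ n) → (∀ i → lookup f i ∈ L i) → f ∈ choices n L
∈-choices⁺ zero L Vec.[] _ = here refl
∈-choices⁺ (suc n) L (c Vec.∷ t) f∈L =
  subst (_ ∈_) (sym (choices-suc n L))
    (∈-cartesianProductWith⁺ Vec._∷_ (f∈L zero) (∈-choices⁺ n (L ∘ suc) t (f∈L ∘ suc)))

choices-unique : ∀ n (L : Fin n → List ℕ) → (∀ i → Unique (L i)) → Unique (choices n L)
choices-unique zero L _ = [] ∷ []
choices-unique (suc n) L u =
  subst Unique (sym (choices-suc n L))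
    (cartesianProductWith⁺ Vec._∷_ ∷-injective (u zero) (choices-unique n (L ∘ suc) (u ∘ suc)))

ProperFn : (G : Graph) → (Fin (size G) → ℕ) → Set
ProperFn G g = ∀ u v → adj G u v ≡ true → g u ≢ g v

LColorableFn : (G : Graph) → ListAssignment G → Set
LColorableFn G L = ∃ λ (g : Fin (size G) → ℕ) → ProperFn G g × ∀ v → g v ∈ L v

module _ (G : Graph) where

  tabulate-proper : ∀ {g} → ProperFn G g → Proper G (tabulate g)
  tabulate-proper {g} p u v e rewrite lookup∘tabulate g u | lookup∘tabulate g v = p u v e

  tabulate-colorable : ∀ {k} g → ProperFn G g → (∀ v → g v < k) → Colorable G k
  tabulate-colorable {k} g p g<k =
    tabulate g , tabulate-proper p , λ v → subst (_< k) (sym (lookup∘tabulate g v)) (g<k v)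

  tabulate-LColoring : ∀ {L g} → ProperFn G g → (∀ v → g v ∈ L v) → IsLColoring G L (tabulate g)
  tabulate-LColoring {L} {g} p g∈L =
    tabulate-proper p , λ v → subst (_∈ L v) (sym (lookup∘tabulate g v)) (g∈L v)

  LColorableFn⇒LColorable : ∀ {L} → LColorableFn G L → LColorable G L
  LColorableFn⇒LColorable (g , p , g∈L) = tabulate g , tabulate-LColoring p g∈L

  LColorable⇒LColorableFn : ∀ {L} → LColorable G L → LColorableFn G L
  LColorable⇒LColorableFn (f , p , f∈L) = lookup f , p , f∈L

  at-least-weaken : ∀ {k k' A} → k ≤ k' → IsAtLeastKAssignment G k' A → IsAtLeastKAssignment G k A
  at-least-weaken k≤k' sizes v = proj₁ (sizes v) , ≤-trans k≤k' (proj₂ (sizes v))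

  ∖-at-least : ∀ {k A} → IsAtLeastKAssignment G (suc k) A → ∀ c → IsAtLeastKAssignment G k (A ∖ c)
  ∖-at-least sizes c v with sizes v
  ... | unique , long = remove-unique unique , ≤-pred (≤-trans long (length-remove unique))

  LColorable-mono : ∀ {B D : ListAssignment G} → (∀ v {x} → x ∈ B v → x ∈ D v) →
    LColorable G B → LColorable G D
  LColorable-mono B⊆D (f , p , f∈B) = f , p , λ v → B⊆D v (f∈B v)

  LColorable-without-vertices : ∀ {L} → ¬ Fin (size G) → LColorable G L
  LColorable-without-vertices noVertex =
    tabulate (⊥-elim ∘ noVertex) , (λ u → ⊥-elim (noVertex u)) , λ v → ⊥-elim (noVertex v)

  LColorable? : ∀ L → Dec (LColorable G L)
  LColorable? L = map′
    (λ ∃proper → let f , f∈ , p = find ∃proper in f , p , ∈-choices⁻ (size G) L f∈)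
    (λ (f , p , f∈L) → lose (∈-choices⁺ (size G) L f f∈L) p)
    (any? (proper? G) (choices (size G) L))

  lcolorings : ListAssignment G → List (Coloring G)
  lcolorings L = filter (proper? G) (choices (size G) L)

  ∈-lcolorings⁻ : ∀ {L f} → f ∈ lcolorings L → IsLColoring G L f
  ∈-lcolorings⁻ {L} f∈ with ∈-filter⁻ (proper? G) {xs = choices (size G) L} f∈
  ... | f∈choices , p = p , ∈-choices⁻ (size G) L f∈choices

  ∈-lcolorings⁺ : ∀ {L f} → IsLColoring G L f → f ∈ lcolorings L
  ∈-lcolorings⁺ {L} {f} (p , f∈L) = ∈-filter⁺ (proper? G) (∈-choices⁺ (size G) L f f∈L) p

  lcolorings-unique : ∀ {L} → (∀ v → Unique (L v)) → Unique (lcolorings L)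
  lcolorings-unique {L} u = filter⁺ (proper? G) (choices-unique (size G) L u)

  palette⇒colorable : ∀ T → LColorableFn G (λ _ → T) → Colorable G (length T)
  palette⇒colorable T (g , p , g∈T) =
    tabulate-colorable (toℕ ∘ position) proper (Fin.toℕ<n ∘ position)
    where
    position : ∀ v → Fin (length T)
    position v = index (g∈T v)
    proper : ProperFn G (toℕ ∘ position)
    proper u v e same = p u v e (begin
      g u                           ≡⟨ lookup-index (g∈T u) ⟩
      List.lookup T (position u)    ≡⟨ cong (List.lookup T) (Fin.toℕ-injective same) ⟩
      List.lookup T (position v)    ≡⟨ lookup-index (g∈T v) ⟨
      g v                           ∎)
      where open ≡-Reasoning

  colorable⇒palette : ∀ {k} → Colorable G k → ∀ T → Unique T → k ≤ length T →
    LColorableFn G (λ _ → T)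
  colorable⇒palette (f , p , f<k) T u k≤|T| = g , proper , λ v → ∈-lookup (position v)
    where
    position : ∀ v → Fin (length T)
    position v = fromℕ< (<-≤-trans (f<k v) k≤|T|)
    g : Fin (size G) → ℕ
    g = List.lookup T ∘ position
    proper : ProperFn G g
    proper u' v e same = p u' v e (begin
      lookup f u'         ≡⟨ Fin.toℕ-fromℕ< _ ⟨
      toℕ (position u')   ≡⟨ cong toℕ (lookup-injective u same) ⟩
      toℕ (position v)    ≡⟨ Fin.toℕ-fromℕ< _ ⟩
      lookup f v          ∎)
      where open ≡-Reasoning

  constant⇒LColorableFn : ∀ {k D} → IsConstant G D → ∀ v → Unique (D v) → k ≤ length (D v) →
    Colorable G k → LColorableFn G D
  constant⇒LColorableFn {D = D} const v u k≤ col with colorable⇒palette col (D v) u k≤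
  ... | g , p , g∈Dv = g , p , λ w → const v w (g w) (g∈Dv w)

  choosable⇒colorable : ∀ {j} → Choosable G j → Colorable G j
  choosable⇒colorable {j} choose = subst (Colorable G) (length-upTo j)
    (palette⇒colorable (upTo j) (LColorable⇒LColorableFn (choose (λ _ → upTo j) sizes)))
    where
    sizes : IsAtLeastKAssignment G j (λ _ → upTo j)
    sizes _ = upTo⁺ j , ≤-reflexive (sym (length-upTo j))

module _ (G H : Graph) where

  -- adj (G □ H) i j unfolds definitionally to □-edge (remQuot i) (remQuot j).
  □-edge : Fin (size G) × Fin (size H) → Fin (size G) × Fin (size H) → Bool
  □-edge (u , a) (u' , b) = (⌊ u Fin.≟ u' ⌋ ∧ adj H a b) ∨ (⌊ a Fin.≟ b ⌋ ∧ adj G u u')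

  □-adj-combine : ∀ u a u' b → adj (G □ H) (combine u a) (combine u' b) ≡ □-edge (u , a) (u' , b)
  □-adj-combine u a u' b = cong₂ □-edge (Fin.remQuot-combine u a) (Fin.remQuot-combine u' b)

  □-edge⁻ : ∀ u a u' b → □-edge (u , a) (u' , b) ≡ true →
    (u ≡ u' × adj H a b ≡ true) ⊎ (a ≡ b × adj G u u' ≡ true)
  □-edge⁻ u a u' b e with u Fin.≟ u' | adj H a b | a Fin.≟ b | adj G u u'
  ... | yes u≡u' | true  | _       | _    = inj₁ (u≡u' , refl)
  ... | _        | _     | yes a≡b | true = inj₂ (a≡b , refl)
  □-edge⁻ u a u' b () | yes _ | false | yes _ | false
  □-edge⁻ u a u' b () | yes _ | false | no _  | _
  □-edge⁻ u a u' b () | no _  | _     | yes _ | false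
  □-edge⁻ u a u' b () | no _  | _     | no _  | _

  □-proper : (F : Fin (size G) → Fin (size H) → ℕ) →
    (∀ a → ProperFn G (λ u → F u a)) → (∀ u → ProperFn H (F u)) →
    ProperFn (G □ H) (uncurry F ∘ remQuot (size H))
  □-proper F layers fibres i j = proper (remQuot (size H) i) (remQuot (size H) j)
    where
    proper : ∀ p q → □-edge p q ≡ true → uncurry F p ≢ uncurry F q
    proper (u , a) (u' , b) e with □-edge⁻ u a u' b e
    ... | inj₁ (refl , ab)  = fibres u a b ab
    ... | inj₂ (refl , uu') = layers a u u' uu'

  □-layer-proper : ∀ {f} → ProperFn (G □ H) f → ∀ a → ProperFn G (λ u → f (combine u a))
  □-layer-proper p a u u' e = p (combine u a) (combine u' a) (trans (□-adj-combine u a u' a) edge)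
    where
    edge : □-edge (u , a) (u' , a) ≡ true
    edge with a Fin.≟ a
    ... | yes _  rewrite e = ∨-zeroʳ _
    ... | no a≢a = contradiction refl a≢a

  □-fibre-proper : ∀ {f} → ProperFn (G □ H) f → ∀ u → ProperFn H (λ a → f (combine u a))
  □-fibre-proper p u a b e = p (combine u a) (combine u b) (trans (□-adj-combine u a u b) edge)
    where
    edge : □-edge (u , a) (u , b) ≡ true
    edge with u Fin.≟ u
    ... | yes _  rewrite e = refl
    ... | no u≢u = contradiction refl u≢u

  layer : ListAssignment (G □ H) → Fin (size H) → ListAssignment G
  layer L a u = L (combine u a)

  product-assignment : (Fin (size G) → Fin (size H) → List ℕ) → ListAssignment (G □ H)
  product-assignment LL = uncurry LL ∘ remQuot (size H)

  layer-product-assignment : ∀ LL a u → layer (product-assignment LL) a u ≡ LL u a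
  layer-product-assignment LL a u = cong (uncurry LL) (Fin.remQuot-combine u a)

  layer-at-least : ∀ {k L} → IsAtLeastKAssignment (G □ H) k L → ∀ a → IsAtLeastKAssignment G k (layer L a)
  layer-at-least sizes a u = sizes (combine u a)

  □-layer-colorable : ∀ {L} → LColorable (G □ H) L → ∀ a → LColorableFn G (layer L a)
  □-layer-colorable (f , p , f∈L) a =
    (λ u → lookup f (combine u a)) , □-layer-proper p a , λ u → f∈L (combine u a)

  □-choosable⇒choosable : ∀ {j} → Fin (size H) → Choosable (G □ H) j → Choosable G j
  □-choosable⇒choosable a choose A sizes
    with □-layer-colorable (choose (product-assignment (λ u _ → A u)) (sizes ∘ proj₁ ∘ remQuot (size H))) a
  ... | g , p , g∈ =
    LColorableFn⇒LColorable G (g , p , λ u → subst (g u ∈_) (layer-product-assignment (λ u _ → A u) a u) (g∈ u))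

module _ (G : Graph) (s : ℕ) where

  star-proper : ∀ {g : Fin (suc s) → ℕ} → (∀ i → g zero ≢ g (suc i)) → ProperFn (Star s) g
  star-proper centre≢leaf zero    (suc i) _ = centre≢leaf i
  star-proper centre≢leaf (suc i) zero    _ = centre≢leaf i ∘ sym
  star-proper _           zero    zero    ()
  star-proper _           (suc _) (suc _) ()

  □-star-colorable : ∀ L (c : Fin (size G) → ℕ) → ProperFn G c →
    (∀ u → c u ∈ layer G (Star s) L zero u) →
    (∀ i → LColorableFn G (layer G (Star s) L (suc i) ∖ c)) →
    LColorable (G □ Star s) L
  □-star-colorable L c c-proper c∈L leaves = LColorableFn⇒LColorable (G □ Star s)
    (uncurry F ∘ remQuot (suc s) , □-proper G (Star s) F layers fibres , members)
    where
    F : Fin (size G) → Fin (suc s) → ℕ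
    F u zero    = c u
    F u (suc i) = proj₁ (leaves i) u
    leaf∈ : ∀ i u → F u (suc i) ∈ layer G (Star s) L (suc i) u × F u (suc i) ≢ c u
    leaf∈ i u = ∈-remove⁻ _ (proj₂ (proj₂ (leaves i)) u)
    layers : ∀ a → ProperFn G (λ u → F u a)
    layers zero    = c-proper
    layers (suc i) = proj₁ (proj₂ (leaves i))
    fibres : ∀ u → ProperFn (Star s) (F u)
    fibres u = star-proper λ i → proj₂ (leaf∈ i u) ∘ sym
    member : ∀ u a → F u a ∈ layer G (Star s) L a u
    member u zero    = c∈L u
    member u (suc i) = proj₁ (leaf∈ i u)
    members : ∀ p → uncurry F (remQuot (suc s) p) ∈ L p
    members p = subst (λ q → uncurry F (remQuot (suc s) p) ∈ L q) (Fin.combine-remQuot {size G} (suc s) p)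
                  (uncurry member (remQuot (suc s) p))

  □-star-leaf-palette : ∀ {f} → ProperFn (G □ Star s) f → ∀ i S →
    (∀ (u : Fin (size G)) → f (combine u (suc i)) ∈ f (combine u zero) ∷ S) →
    LColorableFn G (λ _ → S)
  □-star-leaf-palette {f} p i S f∈ =
    (λ u → f (combine u (suc i))) , □-layer-proper G (Star s) p (suc i) , avoid
    where
    avoid : ∀ u → f (combine u (suc i)) ∈ S
    avoid u with f∈ u
    ... | here same = contradiction (sym same) (□-fibre-proper G (Star s) p u zero (suc i) refl)
    ... | there f∈S = f∈S

  star-lists : ListAssignment G → (Fin s → Coloring G) → List ℕ →
    Fin (size G) → Fin (suc s) → List ℕ
  star-lists L₀ e S u zero    = L₀ u
  star-lists L₀ e S u (suc i) = lookup (e i) u ∷ S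

  star-lists-size : ∀ {j L₀ e S} → IsKAssignment G (suc j) L₀ → Unique S → length S ≡ j →
    (∀ i u → lookup (e i) u ∉ S) →
    IsAtLeastKAssignment (G □ Star s) (suc j) (product-assignment G (Star s) (star-lists L₀ e S))
  star-lists-size {j} {L₀} {e} {S} L₀-size S-unique |S| e∉S = uncurry sizes ∘ remQuot (suc s)
    where
    sizes : ∀ u a → Unique (star-lists L₀ e S u a) × suc j ≤ length (star-lists L₀ e S u a)
    sizes u zero    = proj₁ (L₀-size u) , ≤-reflexive (sym (proj₂ (L₀-size u)))
    sizes u (suc i) = ¬Any⇒All¬ S (e∉S i u) ∷ S-unique , s≤s (≤-reflexive (sym |S|))

  star-lists-colorable⇒palette : ∀ {L₀ e S} → (∀ {x} → x ∈ lcolorings G L₀ → ∃ λ i → e i ≡ x) →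
    LColorable (G □ Star s) (product-assignment G (Star s) (star-lists L₀ e S)) →
    LColorableFn G (λ _ → S)
  star-lists-colorable⇒palette {L₀} {e} {S} onto col with LColorable⇒LColorableFn (G □ Star s) col
  ... | f , p , f∈L = leaf (onto (∈-lcolorings⁺ G centre-coloring))
    where
    f∈LL : ∀ a u → f (combine u a) ∈ star-lists L₀ e S u a
    f∈LL a u = subst (_ ∈_) (layer-product-assignment G (Star s) (star-lists L₀ e S) a u) (f∈L (combine u a))
    centre : Fin (size G) → ℕ
    centre u = f (combine u zero)
    centre-coloring : IsLColoring G L₀ (tabulate centre)
    centre-coloring = tabulate-LColoring G (□-layer-proper G (Star s) p zero) (f∈LL zero)
    leaf : (∃ λ i → e i ≡ tabulate centre) → LColorableFn G (λ _ → S)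
    leaf (i , ei≡centre) = □-star-leaf-palette p i S λ u →
      subst (λ d → _ ∈ d ∷ S) (trans (cong (λ x → lookup x u) ei≡centre) (lookup∘tabulate centre u))
        (f∈LL (suc i) u)

  □-star-not-choosable : ∀ {j} → ¬ Colorable G j → ∀ L₀ → IsKAssignment G (suc j) L₀ →
    numLColorings G L₀ ≤ s → ¬ Choosable (G □ Star s) (suc j)
  □-star-not-choosable {j} ¬col L₀ L₀-size few choose
    with enumerate (replicate (size G) 0) (lcolorings G L₀) few
  ... | e , onto with fresh-colors (concatMap (λ i → List.tabulate (lookup (e i))) (allFin s)) j
  ... | S , S-unique , |S| , S-fresh =
    ¬col (subst (Colorable G) |S| (palette⇒colorable G S
      (star-lists-colorable⇒palette onto (choose _ (star-lists-size L₀-size S-unique |S| forbidden)))))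
    where
    forbidden : ∀ i u → lookup (e i) u ∉ S
    forbidden i u e∈S = S-fresh e∈S (∈-concatMap⁺ _ (lose (∈-allFin i) (∈-tabulate⁺ u)))

module _ {r : ℕ} {M : Graph} (strong : StrongChromaticChoosable M (2 + r)) where

  private
    χ : ChromaticNumber M (2 + r)
    χ = proj₁ strong

  -- B is a (1 + r)-subassignment of D with x ∈ B v, so it is uncolorable and hence constant.
  uncolorable⇒constant : ∀ {D} → IsAtLeastKAssignment M (suc r) D → ¬ LColorable M D → IsConstant M D
  uncolorable⇒constant {D} D-size ¬col v w x x∈Dv =
    B⊆D w (proj₂ strong B B-size (¬col ∘ LColorable-mono M B⊆D) v w x x∈Bv)
    where
    R : List ℕ
    R = remove x (D v)
    B : ListAssignment M
    B u with u Fin.≟ v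
    ... | yes _ = x ∷ take r R
    ... | no  _ = take (suc r) (D u)
    B⊆D : ∀ u {y} → y ∈ B u → y ∈ D u
    B⊆D u y∈B with u Fin.≟ v
    B⊆D u (here refl) | yes refl = x∈Dv
    B⊆D u (there y∈R) | yes refl = proj₁ (∈-remove⁻ (D v) (∈-take y∈R))
    ... | no _ = ∈-take y∈B
    x∈Bv : x ∈ B v
    x∈Bv with v Fin.≟ v
    ... | yes _  = here refl
    ... | no v≢v = contradiction refl v≢v
    B-size : IsKAssignment M (suc r) B
    B-size u with u Fin.≟ v
    ... | yes _ = x∉ ∷ take⁺ r (remove-unique (proj₁ (D-size v))) , cong suc (length-take-≤ {xs = R} r≤|R|)
      where
      x∉ : All (x ≢_) (take r R)
      x∉ = ¬Any⇒All¬ _ (λ x∈ → proj₂ (∈-remove⁻ (D v) (∈-take x∈)) refl)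
      r≤|R| : r ≤ length R
      r≤|R| = proj₂ (∖-at-least M D-size (λ _ → x) v)
    ... | no _ = take⁺ (suc r) (proj₁ (D-size u)) , length-take-≤ {xs = D u} (proj₂ (D-size u))

  ∖-uncolorable⇒∈ : ∀ {A} → IsAtLeastKAssignment M (2 + r) A → ∀ c →
    ¬ LColorable M (A ∖ c) → ∀ v → c v ∈ A v
  ∖-uncolorable⇒∈ {A} A-size c ¬col v with c v ∈? A v
  ... | yes c∈A = c∈A
  ... | no c∉A = contradiction (LColorableFn⇒LColorable M
                   (constant⇒LColorableFn M (uncolorable⇒constant (∖-at-least M A-size c) ¬col) v
                     (remove-unique (proj₁ (A-size v))) long (proj₁ χ))) ¬col
    where
    long : 2 + r ≤ length ((A ∖ c) v)
    long = subst (λ xs → 2 + r ≤ length xs) (sym (remove-∉ c∉A)) (proj₂ (A-size v))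

  ∖-uncolorable-unique : ∀ {A} → IsAtLeastKAssignment M (2 + r) A → ∀ c c' → ProperFn M c' →
    ¬ LColorable M (A ∖ c) → ¬ LColorable M (A ∖ c') → ∀ v → c v ≡ c' v
  ∖-uncolorable-unique {A} A-size c c' c'-proper ¬col ¬col' v with c v ≟ c' v
  ... | yes c≡c' = c≡c'
  ... | no c≢c' = ⊥-elim (proj₂ χ 1 (s≤s (s≤s z≤n))
                    (palette⇒colorable M (c' v ∷ []) (c' , c'-proper , λ w → here (c'-constant w))))
    where
    c'v∈A : ∀ w → c' v ∈ A w
    c'v∈A w = proj₁ (∈-remove⁻ (A w) (uncolorable⇒constant (∖-at-least M A-size c) ¬col v w (c' v)
                (∈-remove⁺ (∖-uncolorable⇒∈ A-size c' ¬col' v) (c≢c' ∘ sym))))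
    c'-constant : ∀ w → c' w ≡ c' v
    c'-constant w with c' w ≟ c' v
    ... | yes same = same
    ... | no differ = contradiction refl (proj₂ (∈-remove⁻ (A v)
                        (uncolorable⇒constant (∖-at-least M A-size c') ¬col' w v (c' v)
                          (∈-remove⁺ (c'v∈A w) (differ ∘ sym)))))

  choosable : Choosable M (2 + r)
  choosable A A-size with LColorable? M A
  ... | yes col = col
  ... | no ¬col with vertex-or-empty (size M)
  ...   | inj₂ none = LColorable-without-vertices M none
  ...   | inj₁ v = LColorableFn⇒LColorable M
                     (constant⇒LColorableFn M (uncolorable⇒constant (at-least-weaken M (n≤1+n _) A-size) ¬col)
                       v (proj₁ (A-size v)) (proj₂ (A-size v)) (proj₁ χ))

  □-star-choosable : ∀ {s m} → IsListColorFunctionValue M (2 + r) m → s < m →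
    Choosable (M □ Star s) (2 + r)
  □-star-choosable {s} {m} (_ , minimal) s<m L L-size
    with ∃-common-witness s (lcolorings M centre) (lcolorings-unique M (proj₁ ∘ centre-size))
           (<-≤-trans s<m (minimal centre centre-size)) (λ i x → LColorable M (leaf i ∖ lookup x))
           (λ i x → LColorable? M _) obstructs-at-most-one
    where
    centre : ListAssignment M
    centre u = take (2 + r) (layer M (Star s) L zero u)
    centre-size : IsKAssignment M (2 + r) centre
    centre-size u = take⁺ (2 + r) (proj₁ (L-size (combine u zero))) ,
                    length-take-≤ {xs = L (combine u zero)} (proj₂ (L-size (combine u zero)))
    leaf : Fin s → ListAssignment M
    leaf i = layer M (Star s) L (suc i)
    obstructs-at-most-one : ∀ i {x y} → x ∈ lcolorings M centre → y ∈ lcolorings M centre →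
      ¬ LColorable M (leaf i ∖ lookup x) → ¬ LColorable M (leaf i ∖ lookup y) → x ≡ y
    obstructs-at-most-one i _ y∈ ¬col ¬col' = Pointwise-≡⇒≡ (ext
      (∖-uncolorable-unique (layer-at-least M (Star s) L-size (suc i)) _ _ (proj₁ (∈-lcolorings⁻ M y∈)) ¬col ¬col'))
  ... | x , x∈C , leaves-colorable with ∈-lcolorings⁻ M x∈C
  ...   | x-proper , x∈centre = □-star-colorable M s L (lookup x) x-proper (∈-take ∘ x∈centre)
                                  (LColorable⇒LColorableFn M ∘ leaves-colorable)

  □-star-choosable-suc : ∀ {s} → Choosable (M □ Star s) (3 + r)
  □-star-choosable-suc {s} L L-size
    with LColorable⇒LColorableFn M (choosable _ (at-least-weaken M (n≤1+n _) (layer-at-least M (Star s) L-size zero)))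
  ... | c , c-proper , c∈L = □-star-colorable M s L c c-proper c∈L λ i →
    LColorable⇒LColorableFn M (choosable _ (∖-at-least M (layer-at-least M (Star s) L-size (suc i)) c))

theorem5p5 : (k : ℕ) → 2 ≤ k → (M : Graph) → IsSimple M →
             StrongChromaticChoosable M k →
             (m : ℕ) → IsListColorFunctionValue M k m →
             (s : ℕ) → 1 ≤ s →
             (s < m → ListChromaticNumber (M □ Star s) k) ×
             (m ≤ s → ListChromaticNumber (M □ Star s) (suc k))
theorem5p5 (suc (suc r)) (s≤s (s≤s z≤n)) M _ strong m Pℓ s _ =
  (λ s<m → □-star-choosable strong Pℓ s<m , below-k) ,
  (λ m≤s → □-star-choosable-suc strong ,
            λ j j≤k → [ below-k j , (λ { refl → not-k m≤s }) ]′ (m≤n⇒m<n∨m≡n (≤-pred j≤k)))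
  where
  χ : ChromaticNumber M (2 + r)
  χ = proj₁ strong
  below-k : ∀ j → j < 2 + r → ¬ Choosable (M □ Star s) j
  below-k j j<k = proj₂ χ j j<k ∘ choosable⇒colorable M ∘ □-choosable⇒choosable M (Star s) zero
  not-k : m ≤ s → ¬ Choosable (M □ Star s) (2 + r)
  not-k m≤s with proj₁ Pℓ
  ... | L₀ , L₀-size , count =
    □-star-not-choosable M s (proj₂ χ (suc r) ≤-refl) L₀ L₀-size (subst (_≤ s) (sym count) m≤s)
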